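{- Let $m\ge1$ and $n>1$ be integers, let $\xi_m$ be a primitive $m$-th root of unity, and suppose there exist a prime $p\equiv1\pmod m$ and an integer $k\ge1$ such that $n=p^kn'$ with $p\nmid n'$. Then: (a) if $n'\ne m$, then $\Phi_n(\xi_m)=1$; (b) if $n'=m$, then $\Phi_n(\xi_m)=p$.
   Context: $\Phi_n(x)=\prod_{1\le j\le n,\ \gcd(j,n)=1}(x-e^{2\pi i j/n})$ is the $n$-th cyclotomic polynomial. A primitive $m$-th root of unity is a complex $z$ with $z^m=1$ but $z^d\ne1$ for $1\le d<m$. -}

module Defs where

open import Level using (Level; _⊔_) renaming (suc to lsuc)
open import Data.Nat as ℕ using (ℕ; zero; suc; _≤_; _<_)
open import Data.Nat.Coprimality using (coprime?)
open import Data.Product using (Σ) renaming (_×_ to _∧_)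
open import Relation.Nullary using (¬_; yes; no)
open import Algebra.Bundles using (CommutativeRing; Semiring)

module RingOps {c ℓ} (R : CommutativeRing c ℓ) where
  open CommutativeRing R public
  open import Algebra.Definitions.RawSemiring (Semiring.rawSemiring semiring) public
    using (_×_; _^_)

record Char0Field (c ℓ : Level) : Set (lsuc (c ⊔ ℓ)) where
  field
    commRing : CommutativeRing c ℓ
  open RingOps commRing public
  field
    1≉0     : ¬ (1# ≈ 0#)
    inverse : ∀ x → ¬ (x ≈ 0#) → Σ Carrier (λ y → x * y ≈ 1#)
    char0   : ∀ k → ¬ (suc k × 1# ≈ 0#)

module _ {c ℓ} (F : Char0Field c ℓ) where
  open Char0Field F

  IsPrimitiveRoot : ℕ → Carrier → Set ℓ
  IsPrimitiveRoot m z = (z ^ m ≈ 1#) ∧ (∀ d → 1 ≤ d → d < m → ¬ (z ^ d ≈ 1#))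

  partialΦ : ℕ → Carrier → Carrier → ℕ → Carrier
  partialΦ n ζ x zero = 1#
  partialΦ n ζ x (suc j) with coprime? (suc j) n
  ... | yes _ = (x - ζ ^ suc j) * partialΦ n ζ x j
  ... | no  _ = partialΦ n ζ x j

  -- Φ_n evaluated at x, where ζ is a primitive n-th root of unity
  -- (playing the role of e^{2πi/n}):
  -- Φ_n(x) = ∏_{1 ≤ j ≤ n, gcd(j,n)=1} (x - ζ^j)
  cycloEval : ℕ → Carrier → Carrier → Carrier
  cycloEval n ζ x = partialΦ n ζ x n

{-# OPTIONS --safe #-}
module Submission where

-- Write n = p·q·a with q = p^(k-1) and a = n′, and let θ = ζ^(pq), a primitive a-th root of
-- unity. As ∏_{t<e} (x - b·ω^t) = x^e - b^e for a primitive e-th root ω, substituting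
-- j = r + t·a folds a product ∏_{j<n, U j} (ξ - ζ^j), for U periodic mod a, into
-- ∏_{r<a, U r} (ξ^(pq) - θ^r), and ξ^p = ξ because m ∣ p - 1. The same folding applies to the
-- factors with p ∣ j, which are those of ζ^p, a primitive (qa)-th root. For U = "coprime to a"
-- both products equal Φ_a(ξ), and Φ_n(ξ) is their quotient, so Φ_n(ξ) = 1 unless Φ_a(ξ) = 0,
-- i.e. unless ξ is a primitive a-th root, i.e. a = m. If a = m, the same argument for
-- U = "not coprime to a" leaves Φ_n(ξ) = ∏_{p ∤ j} (ξ - ζ^j) = 1 + y + ⋯ + y^(p-1) at
-- y = ξ^(qa) = 1, which is p. Both product formulas are proved by comparing a monic polynomial
-- function with the product of the linear factors at its roots.

open import Defs
open import Level using (Level; _⊔_)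
open import Algebra.Bundles using (CommutativeMonoid)
open import Data.Bool using (if_then_else_)
open import Data.Empty using (⊥-elim)
open import Data.Maybe using (nothing)
open import Data.Nat as ℕ using (ℕ; zero; suc; _≤_; _<_; s≤s; z≤n)
open import Data.Nat.Coprimality as Coprimality using (Coprime; coprime?; coprime-divisor)
open import Data.Nat.Divisibility
  using ( _∣_; _∣?_; divides; ∣-trans; ∣-refl; ∣-antisym; ∣⇒≤; >⇒∤; ∣1⇒≡1; n∣m*n; m∣m*n
        ; ∣m⇒∣m*n; ∣n⇒∣m*n; ∣m+n∣m⇒∣n; ∣m∣n⇒∣m+n; m%n≡0⇒n∣m; *-cancelʳ-∣)
import Data.Nat.DivMod as DM
open import Data.Nat.Primality using (Prime; prime⇒irreducible; ¬prime[1])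
open import Data.Nat.Properties using (+-0-commutativeMonoid)
import Data.Nat.Properties as ℕ
open import Data.Product using (Σ; _,_; proj₁; proj₂; _×_)
open import Data.Sum using (inj₁; inj₂)
open import Data.Unit using (⊤; tt)
open import Function using (_∘_; _⇔_; mk⇔; Equivalence)
open import Relation.Binary.PropositionalEquality as ≡ using (_≡_; _≢_)
open import Relation.Nullary using (¬_; Dec; yes; no; does; ¬?)
open import Relation.Unary using (Pred; Decidable)

¬-cong-⇔ : ∀ {a b} {A : Set a} {B : Set b} → A ⇔ B → (¬ A) ⇔ (¬ B)
¬-cong-⇔ A⇔B = mk⇔ (_∘ Equivalence.from A⇔B) (_∘ Equivalence.to A⇔B)

coprime-* : ∀ {j a b} → Coprime j a → Coprime j b → Coprime j (a ℕ.* b)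
coprime-* j⊥a j⊥b (d∣j , d∣ab) =
  j⊥b (d∣j , coprime-divisor (λ (e∣d , e∣a) → j⊥a (∣-trans e∣d d∣j , e∣a)) d∣ab)

coprime-^ : ∀ {j a} → Coprime j a → ∀ k → Coprime j (a ℕ.^ k)
coprime-^ _   zero    (_ , d∣1) = ∣1⇒≡1 d∣1
coprime-^ j⊥a (suc k) = coprime-* j⊥a (coprime-^ j⊥a k)

¬∣⇒coprime : ∀ {p j} → Prime p → ¬ p ∣ j → Coprime j p
¬∣⇒coprime p-prime p∤j (d∣j , d∣p) with prime⇒irreducible p-prime d∣p
... | inj₁ d≡1    = d≡1
... | inj₂ ≡.refl = ⊥-elim (p∤j d∣j)

coprime-p^k*a⇔ : ∀ {p j a} → Prime p → ∀ k →
  Coprime j (p ℕ.^ suc k ℕ.* a) ⇔ (¬ p ∣ j × Coprime j a)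
coprime-p^k*a⇔ {p} {j} {a} p-prime k = mk⇔ to from
  where
  p∣pᵏ⁺¹a : p ∣ p ℕ.^ suc k ℕ.* a
  p∣pᵏ⁺¹a = ∣m⇒∣m*n a (m∣m*n (p ℕ.^ k))
  to : Coprime j (p ℕ.^ suc k ℕ.* a) → ¬ p ∣ j × Coprime j a
  to j⊥n = (λ p∣j → ¬prime[1] (≡.subst Prime (j⊥n (p∣j , p∣pᵏ⁺¹a)) p-prime))
         , λ (d∣j , d∣a) → j⊥n (d∣j , ∣n⇒∣m*n (p ℕ.^ suc k) d∣a)
  from : ¬ p ∣ j × Coprime j a → Coprime j (p ℕ.^ suc k ℕ.* a)
  from (p∤j , j⊥a) = coprime-* (coprime-^ (¬∣⇒coprime p-prime p∤j) (suc k)) j⊥a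

coprime-+*⇔ : ∀ {r a} t → Coprime (r ℕ.+ t ℕ.* a) a ⇔ Coprime r a
coprime-+*⇔ {r} {a} t = mk⇔
  (λ s⊥a {_} (d∣r , d∣a) → s⊥a (∣m∣n⇒∣m+n d∣r (∣n⇒∣m*n t d∣a) , d∣a))
  (λ r⊥a {d} (d∣s , d∣a) →
    r⊥a (∣m+n∣m⇒∣n (≡.subst (d ∣_) (ℕ.+-comm r (t ℕ.* a)) d∣s) (∣n⇒∣m*n t d∣a) , d∣a))

coprime-*p⇔ : ∀ {p a r} → Prime p → ¬ p ∣ a → Coprime (r ℕ.* p) a ⇔ Coprime r a
coprime-*p⇔ {p} {a} {r} p-prime p∤a = mk⇔
  (λ rp⊥a {_} (d∣r , d∣a) → rp⊥a (∣m⇒∣m*n p d∣r , d∣a))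
  (λ r⊥a {d} (d∣rp , d∣a) →
    r⊥a (coprime-divisor (d⊥p d∣a) (≡.subst (d ∣_) (ℕ.*-comm r p) d∣rp) , d∣a))
  where
  d⊥p : ∀ {d} → d ∣ a → Coprime d p
  d⊥p d∣a (e∣d , e∣p) = Coprimality.sym (¬∣⇒coprime p-prime p∤a) (e∣p , ∣-trans e∣d d∣a)

-- Products over initial segments of ℕ

module Products {c ℓ} (M : CommutativeMonoid c ℓ) where
  open CommutativeMonoid M
  open import Algebra.Properties.CommutativeSemigroup commutativeSemigroup
    using (interchange; x∙yz≈y∙xz)
  open import Relation.Binary.Reasoning.Setoid setoid

  private variable
    ℓ₁ ℓ₂ ℓ₃ : Level
    A : Set ℓ₁
    B : Set ℓ₂
    C : Set ℓ₃

  Π : ℕ → (ℕ → Carrier) → Carrier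
  Π zero    f = ε
  Π (suc n) f = f n ∙ Π n f

  Π-cong : ∀ n {f g : ℕ → Carrier} → (∀ {i} → i < n → f i ≈ g i) → Π n f ≈ Π n g
  Π-cong zero    f≈g = refl
  Π-cong (suc n) f≈g = ∙-cong (f≈g (ℕ.n<1+n n)) (Π-cong n (f≈g ∘ ℕ.m<n⇒m<1+n))

  Π-ε : ∀ n {f : ℕ → Carrier} → (∀ {i} → i < n → f i ≈ ε) → Π n f ≈ ε
  Π-ε n f≈ε = trans (Π-cong n f≈ε) (Π-const-ε n)
    where
    Π-const-ε : ∀ n → Π n (λ _ → ε) ≈ ε
    Π-const-ε zero    = refl
    Π-const-ε (suc n) = trans (identityˡ _) (Π-const-ε n)

  Π-∙ : ∀ n (f g : ℕ → Carrier) → Π n (λ i → f i ∙ g i) ≈ Π n f ∙ Π n g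
  Π-∙ zero    f g = sym (identityˡ ε)
  Π-∙ (suc n) f g = trans (∙-congˡ (Π-∙ n f g)) (interchange (f n) (g n) (Π n f) (Π n g))

  Π-+ : ∀ m n (f : ℕ → Carrier) → Π (m ℕ.+ n) f ≈ Π m (λ i → f (i ℕ.+ n)) ∙ Π n f
  Π-+ zero    n f = sym (identityˡ _)
  Π-+ (suc m) n f = trans (∙-congˡ (Π-+ m n f)) (sym (assoc _ _ _))

  Π-* : ∀ m n (f : ℕ → Carrier) →
    Π (m ℕ.* n) f ≈ Π m (λ t → Π n (λ r → f (r ℕ.+ t ℕ.* n)))
  Π-* zero    n f = refl
  Π-* (suc m) n f = trans (Π-+ n (m ℕ.* n) f) (∙-congˡ (Π-* m n f))

  Π-swap : ∀ m n (f : ℕ → ℕ → Carrier) →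
    Π m (λ r → Π n (f r)) ≈ Π n (λ t → Π m (λ r → f r t))
  Π-swap zero    n f = sym (Π-ε n (λ _ → refl))
  Π-swap (suc m) n f =
    trans (∙-congˡ (Π-swap m n f)) (sym (Π-∙ n (f m) (λ t → Π m (λ r → f r t))))

  Π-suc : ∀ n (f : ℕ → Carrier) → Π (suc n) f ≈ f 0 ∙ Π n (f ∘ suc)
  Π-suc zero    f = refl
  Π-suc (suc n) f = begin
    f (suc n) ∙ (f n ∙ Π n f)          ≈⟨ ∙-congˡ (Π-suc n f) ⟩
    f (suc n) ∙ (f 0 ∙ Π n (f ∘ suc))  ≈⟨ x∙yz≈y∙xz (f (suc n)) (f 0) _ ⟩
    f 0 ∙ (f (suc n) ∙ Π n (f ∘ suc))  ∎

  factorIf : Dec A → Carrier → Carrier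
  factorIf a? y = if does a? then y else ε

  factorIf-yes : (a? : Dec A) → A → ∀ y → factorIf a? y ≈ y
  factorIf-yes (yes _) _ y = refl
  factorIf-yes (no ¬x) x y = ⊥-elim (¬x x)

  factorIf-no : (a? : Dec A) → ¬ A → ∀ y → factorIf a? y ≈ ε
  factorIf-no (yes x) ¬x y = ⊥-elim (¬x x)
  factorIf-no (no _)  _  y = refl

  factorIf-congʳ : (a? : Dec A) → ∀ {y z} → y ≈ z → factorIf a? y ≈ factorIf a? z
  factorIf-congʳ (yes _) y≈z = y≈z
  factorIf-congʳ (no _)  _   = refl

  factorIf-cong : A ⇔ B → (a? : Dec A) (b? : Dec B) → ∀ {y z} → y ≈ z →
    factorIf a? y ≈ factorIf b? z
  factorIf-cong A⇔B (yes x) b? y≈z = trans y≈z (sym (factorIf-yes b? (Equivalence.to A⇔B x) _))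
  factorIf-cong A⇔B (no ¬x) b? y≈z = sym (factorIf-no b? (¬x ∘ Equivalence.from A⇔B) _)

  factorIf-× : A ⇔ (B × C) → (a? : Dec A) (b? : Dec B) (c? : Dec C) → ∀ y →
    factorIf a? y ≈ factorIf b? (factorIf c? y)
  factorIf-× A⇔B×C a? (yes b) (yes c) y = factorIf-yes a? (Equivalence.from A⇔B×C (b , c)) y
  factorIf-× A⇔B×C a? (yes _) (no ¬c) y = factorIf-no a? (¬c ∘ proj₂ ∘ Equivalence.to A⇔B×C) y
  factorIf-× A⇔B×C a? (no ¬b) c?      y = factorIf-no a? (¬b ∘ proj₁ ∘ Equivalence.to A⇔B×C) y

  factorIf-complement : (a? : Dec A) → ∀ y → factorIf a? y ∙ factorIf (¬? a?) y ≈ y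
  factorIf-complement (yes _) y = identityʳ y
  factorIf-complement (no _)  y = identityˡ y

  factorIf-∙ : (a? : Dec A) → ∀ y z → factorIf a? (y ∙ z) ≈ factorIf a? y ∙ factorIf a? z
  factorIf-∙ (yes _) y z = refl
  factorIf-∙ (no _)  y z = sym (identityˡ ε)

  Π-factorIf : ∀ n (a? : Dec A) (f : ℕ → Carrier) →
    Π n (λ i → factorIf a? (f i)) ≈ factorIf a? (Π n f)
  Π-factorIf n (yes _) f = refl
  Π-factorIf n (no _)  f = Π-ε n (λ _ → refl)

  Π-multiples : ∀ m p₁ (f : ℕ → Carrier) →
    Π (m ℕ.* suc p₁) (λ j → factorIf (suc p₁ ∣? j) (f j)) ≈ Π m (λ i → f (i ℕ.* suc p₁))
  Π-multiples m p₁ f =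
    trans (Π-* m p (λ j → factorIf (p ∣? j) (f j))) (Π-cong m (λ {i} _ → block i))
    where
    p = suc p₁
    block : ∀ i → Π p (λ s → factorIf (p ∣? (s ℕ.+ i ℕ.* p)) (f (s ℕ.+ i ℕ.* p))) ≈ f (i ℕ.* p)
    block i = begin
      Π p (λ s → g (s ℕ.+ i ℕ.* p))                    ≈⟨ Π-suc p₁ _ ⟩
      g (i ℕ.* p) ∙ Π p₁ (λ s → g (suc s ℕ.+ i ℕ.* p))  ≈⟨ ∙-cong first (Π-ε p₁ rest) ⟩
      f (i ℕ.* p) ∙ ε                                   ≈⟨ identityʳ _ ⟩
      f (i ℕ.* p)                                       ∎
      where
      g = λ j → factorIf (p ∣? j) (f j)
      first : g (i ℕ.* p) ≈ f (i ℕ.* p)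
      first = factorIf-yes (p ∣? (i ℕ.* p)) (n∣m*n i) _
      rest : ∀ {s} → s < p₁ → g (suc s ℕ.+ i ℕ.* p) ≈ ε
      rest {s} s<p₁ = factorIf-no (p ∣? (suc s ℕ.+ i ℕ.* p)) p∤ _
        where
        p∤ : ¬ p ∣ suc s ℕ.+ i ℕ.* p
        p∤ p∣ = >⇒∤ (s≤s s<p₁)
          (∣m+n∣m⇒∣n (≡.subst (p ∣_) (ℕ.+-comm (suc s) (i ℕ.* p)) p∣) (n∣m*n i))

module Count = Products +-0-commutativeMonoid

count : ∀ {u} {U : Pred ℕ u} → Decidable U → ℕ → ℕ
count U? N = Count.Π N (λ i → Count.factorIf (U? i) 1)

count-all : ∀ N → count {U = λ _ → ⊤} (λ _ → yes tt) N ≡ N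
count-all zero    = ≡.refl
count-all (suc N) = ≡.cong suc (count-all N)

count-complement : ∀ {u} {U : Pred ℕ u} (U? : Decidable U) N →
  count U? N ℕ.+ count (¬? ∘ U?) N ≡ N
count-complement U? N = ≡.trans (≡.sym (Count.Π-∙ N _ _))
  (≡.trans (Count.Π-cong N (λ {i} _ → Count.factorIf-complement (U? i) 1)) (count-all N))

count-∤ : ∀ m p₁ → count (λ j → ¬? (suc p₁ ∣? j)) (m ℕ.* suc p₁) ≡ m ℕ.* p₁
count-∤ m p₁ = ℕ.+-cancelˡ-≡ m _ _ (begin
  m ℕ.+ count p∤? (m ℕ.* p)                        ≡⟨ ≡.cong (ℕ._+ count p∤? (m ℕ.* p)) multiples ⟨
  count (p ∣?_) (m ℕ.* p) ℕ.+ count p∤? (m ℕ.* p)  ≡⟨ count-complement (p ∣?_) (m ℕ.* p) ⟩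
  m ℕ.* p                                           ≡⟨ ℕ.*-suc m p₁ ⟩
  m ℕ.+ m ℕ.* p₁                                    ∎)
  where
  open ≡.≡-Reasoning
  p = suc p₁
  p∤? = λ j → ¬? (p ∣? j)
  multiples : count (p ∣?_) (m ℕ.* p) ≡ m
  multiples = ≡.trans (Count.Π-multiples m p₁ (λ _ → 1)) (count-all m)

module _ {c ℓ} (F : Char0Field c ℓ) where
  open Char0Field F renaming (_×_ to _×ᴿ_)
  open Products *-commutativeMonoid
  open import Relation.Binary.Reasoning.Setoid setoid
  open import Algebra.Properties.Group +-group
    using (//-cong₂; //-rightDividesˡ; x∙y⁻¹≈ε⇒x≈y; x≈y⇒x∙y⁻¹≈ε; ∙-cancelʳ)
  open import Algebra.Properties.Ring ring using ([y-z]x≈yx-zx)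
  open import Algebra.Properties.Semiring.Exp semiring using (^-congˡ; ^-congʳ; ^-homo-*; ^-assocʳ)
  open import Algebra.Properties.CommutativeSemiring.Exp commutativeSemiring using (^-distrib-*)
  open import Algebra.Solver.Ring.NaturalCoefficients commutativeSemiring (λ _ _ → nothing)
    using (solve; _:=_; _:+_; _:*_; con)

  *-cancelˡ : ∀ {x y z} → x ≉ 0# → x * y ≈ x * z → y ≈ z
  *-cancelˡ {x} {y} {z} x≉0 xy≈xz with inverse x x≉0
  ... | x⁻¹ , xx⁻¹≈1 = begin
    y              ≈⟨ sym (*-identityˡ y) ⟩
    1# * y         ≈⟨ *-congʳ (trans (sym xx⁻¹≈1) (*-comm x x⁻¹)) ⟩
    x⁻¹ * x * y    ≈⟨ *-assoc x⁻¹ x y ⟩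
    x⁻¹ * (x * y)  ≈⟨ *-congˡ xy≈xz ⟩
    x⁻¹ * (x * z)  ≈⟨ sym (*-assoc x⁻¹ x z) ⟩
    x⁻¹ * x * z    ≈⟨ *-congʳ (trans (*-comm x⁻¹ x) xx⁻¹≈1) ⟩
    1# * z         ≈⟨ *-identityˡ z ⟩
    z              ∎

  x*y≈0⇒y≈0 : ∀ {x y} → x ≉ 0# → x * y ≈ 0# → y ≈ 0#
  x*y≈0⇒y≈0 {x} x≉0 xy≈0 = *-cancelˡ x≉0 (trans xy≈0 (sym (zeroʳ x)))

  x≉y⇒x-y≉0 : ∀ {x y} → x ≉ y → x - y ≉ 0#
  x≉y⇒x-y≉0 x≉y = x≉y ∘ x∙y⁻¹≈ε⇒x≈y _ _

  x*z≈y*z⇒z≈0 : ∀ {x y z} → x ≉ y → x * z ≈ y * z → z ≈ 0#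
  x*z≈y*z⇒z≈0 {x} {y} {z} x≉y xz≈yz =
    x*y≈0⇒y≈0 (x≉y⇒x-y≉0 x≉y) (trans ([y-z]x≈yx-zx z x y) (x≈y⇒x∙y⁻¹≈ε xz≈yz))

  Π-≉0 : ∀ n {f : ℕ → Carrier} → (∀ {i} → i < n → f i ≉ 0#) → Π n f ≉ 0#
  Π-≉0 zero    f≉0 = 1≉0
  Π-≉0 (suc n) f≉0 Πf≈0 =
    Π-≉0 n (f≉0 ∘ ℕ.m<n⇒m<1+n) (x*y≈0⇒y≈0 (f≉0 (ℕ.n<1+n n)) Πf≈0)

  factorIf-≉0 : ∀ {a} {A : Set a} (a? : Dec A) {y} → (A → y ≉ 0#) → factorIf a? y ≉ 0#
  factorIf-≉0 (yes x) y≉0 = y≉0 x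
  factorIf-≉0 (no _)  _   = 1≉0

  -- Roots of unity

  1^n≈1 : ∀ n → 1# ^ n ≈ 1#
  1^n≈1 zero    = refl
  1^n≈1 (suc n) = trans (*-identityˡ _) (1^n≈1 n)

  ^-comm : ∀ z m n → (z ^ m) ^ n ≈ (z ^ n) ^ m
  ^-comm z m n = trans (^-assocʳ z m n) (trans (^-congʳ z (ℕ.*-comm m n)) (sym (^-assocʳ z n m)))

  ^-≉0 : ∀ {z} n → z ≉ 0# → z ^ n ≉ 0#
  ^-≉0 zero    z≉0 = 1≉0
  ^-≉0 (suc n) z≉0 zzⁿ≈0 = ^-≉0 n z≉0 (x*y≈0⇒y≈0 z≉0 zzⁿ≈0)

  ^-multiple≈1 : ∀ {z n a} → z ^ n ≈ 1# → n ∣ a → z ^ a ≈ 1#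
  ^-multiple≈1 {z} {n} zⁿ≈1 (divides q ≡.refl) = begin
    z ^ (q ℕ.* n)  ≈⟨ ^-congʳ z (ℕ.*-comm q n) ⟩
    z ^ (n ℕ.* q)  ≈⟨ sym (^-assocʳ z n q) ⟩
    (z ^ n) ^ q    ≈⟨ ^-congˡ q zⁿ≈1 ⟩
    1# ^ q         ≈⟨ 1^n≈1 q ⟩
    1#             ∎

  ^-suc-multiple : ∀ {z m d} → z ^ m ≈ 1# → m ∣ d → z ^ suc d ≈ z
  ^-suc-multiple {z} zᵐ≈1 m∣d = trans (*-congˡ (^-multiple≈1 zᵐ≈1 m∣d)) (*-identityʳ z)

  ^-fixed-^ : ∀ {z} p → z ^ p ≈ z → ∀ k → z ^ (p ℕ.^ k) ≈ z
  ^-fixed-^ {z} p zᵖ≈z zero    = *-identityʳ z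
  ^-fixed-^ {z} p zᵖ≈z (suc k) = begin
    z ^ (p ℕ.* p ℕ.^ k)  ≈⟨ sym (^-assocʳ z p (p ℕ.^ k)) ⟩
    (z ^ p) ^ (p ℕ.^ k)  ≈⟨ ^-congˡ (p ℕ.^ k) zᵖ≈z ⟩
    z ^ (p ℕ.^ k)        ≈⟨ ^-fixed-^ p zᵖ≈z k ⟩
    z                    ∎

  IsPrimitiveRoot-resp-≈ : ∀ {n x y} → x ≈ y → IsPrimitiveRoot F n x → IsPrimitiveRoot F n y
  IsPrimitiveRoot-resp-≈ {n} x≈y (xⁿ≈1 , x-order) =
    trans (^-congˡ n (sym x≈y)) xⁿ≈1 ,
    λ d 1≤d d<n yᵈ≈1 → x-order d 1≤d d<n (trans (^-congˡ d x≈y) yᵈ≈1)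

  module _ {N z} (z-prim : IsPrimitiveRoot F (suc N) z) where

    primitive⇒≉0 : z ≉ 0#
    primitive⇒≉0 z≈0 = 1≉0 (trans (sym (proj₁ z-prim)) (trans (*-congʳ z≈0) (zeroˡ _)))

    primitive⇒order∣ : ∀ a → z ^ a ≈ 1# → suc N ∣ a
    primitive⇒order∣ a zᵃ≈1 with a DM.% suc N in a%N≡r
    ... | zero  = m%n≡0⇒n∣m a (suc N) a%N≡r
    ... | suc r = ⊥-elim (proj₂ z-prim (suc r) (s≤s z≤n) r<N (trans (sym zᵃ≈zʳ) zᵃ≈1))
      where
      q = a DM./ suc N
      r<N : suc r < suc N
      r<N = ≡.subst (_< suc N) a%N≡r (DM.m%n<n a (suc N))
      zᵃ≈zʳ : z ^ a ≈ z ^ suc r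
      zᵃ≈zʳ = begin
        z ^ a                           ≡⟨ ≡.cong (z ^_) (≡.trans (DM.m≡m%n+[m/n]*n a (suc N))
                                                                  (≡.cong (ℕ._+ q ℕ.* suc N) a%N≡r)) ⟩
        z ^ (suc r ℕ.+ q ℕ.* suc N)     ≈⟨ ^-homo-* z (suc r) (q ℕ.* suc N) ⟩
        z ^ suc r * z ^ (q ℕ.* suc N)   ≈⟨ *-congˡ (^-multiple≈1 (proj₁ z-prim) (n∣m*n q)) ⟩
        z ^ suc r * 1#                  ≈⟨ *-identityʳ _ ⟩
        z ^ suc r                       ∎

    primitive-^-injective : ∀ {s t} → s < t → t < suc N → z ^ s ≉ z ^ t
    primitive-^-injective {s} {t} s<t t<N zˢ≈zᵗ =
      proj₂ z-prim (t ℕ.∸ s) (ℕ.m<n⇒0<n∸m s<t) (ℕ.≤-<-trans (ℕ.m∸n≤m t s) t<N) zᵗ⁻ˢ≈1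
      where
      zᵗ⁻ˢ≈1 : z ^ (t ℕ.∸ s) ≈ 1#
      zᵗ⁻ˢ≈1 = sym (*-cancelˡ (^-≉0 s primitive⇒≉0) (begin
        z ^ s * 1#              ≈⟨ *-identityʳ _ ⟩
        z ^ s                   ≈⟨ zˢ≈zᵗ ⟩
        z ^ t                   ≈⟨ ^-congʳ z (≡.sym (ℕ.m+[n∸m]≡n (ℕ.<⇒≤ s<t))) ⟩
        z ^ (s ℕ.+ (t ℕ.∸ s))   ≈⟨ ^-homo-* z s (t ℕ.∸ s) ⟩
        z ^ s * z ^ (t ℕ.∸ s)   ∎))

  primitive-order-unique : ∀ {m a z} →
    IsPrimitiveRoot F (suc m) z → IsPrimitiveRoot F (suc a) z → suc m ≡ suc a
  primitive-order-unique {m} {a} zₘ zₐ =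
    ∣-antisym (primitive⇒order∣ zₘ (suc a) (proj₁ zₐ)) (primitive⇒order∣ zₐ (suc m) (proj₁ zₘ))

  primitive-^ : ∀ {z} e m → IsPrimitiveRoot F (suc e ℕ.* m) z → IsPrimitiveRoot F m (z ^ suc e)
  primitive-^ {z} e m (zⁿ≈1 , z-order) =
    trans (^-assocʳ z (suc e) m) zⁿ≈1 ,
    λ d 1≤d d<m zᵉᵈ≈1 → z-order (suc e ℕ.* d) (ℕ.≤-trans 1≤d (ℕ.m≤n*m d (suc e)))
                                (ℕ.*-monoʳ-< (suc e) d<m) (trans (sym (^-assocʳ z (suc e) d)) zᵉᵈ≈1)

  module _ {a θ} (θ-prim : IsPrimitiveRoot F (suc a) θ) where

    primitive-^-coprime : ∀ {r} → Coprime r (suc a) → IsPrimitiveRoot F (suc a) (θ ^ r)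
    primitive-^-coprime {r} r⊥a =
      trans (^-comm θ r (suc a)) (trans (^-congˡ r (proj₁ θ-prim)) (1^n≈1 r)) ,
      λ d 1≤d d<a θʳᵈ≈1 → ℕ.<⇒≱ d<a (∣⇒≤ {{ℕ.>-nonZero 1≤d}}
        (coprime-divisor (Coprimality.sym r⊥a)
          (primitive⇒order∣ θ-prim (r ℕ.* d) (trans (sym (^-assocʳ θ r d)) θʳᵈ≈1))))

    primitive-^⇒coprime : ∀ {r} → IsPrimitiveRoot F (suc a) (θ ^ r) → Coprime r (suc a)
    primitive-^⇒coprime {r} θʳ-prim {d} (divides f ≡.refl , divides e a≡ed) =
      ℕ.*-cancelˡ-≡ d 1 (suc a) (≡.trans (≡.cong (ℕ._* d) (≡.sym e≡a))
                                          (≡.trans (≡.sym a≡ed) (≡.sym (ℕ.*-identityʳ (suc a)))))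
      where
      a∣fd*e : suc a ∣ f ℕ.* d ℕ.* e
      a∣fd*e = ≡.subst (_∣ f ℕ.* d ℕ.* e) (≡.trans (ℕ.*-comm d e) (≡.sym a≡ed))
                 (≡.subst (d ℕ.* e ∣_) (≡.sym (ℕ.*-assoc f d e)) (n∣m*n f))
      e≡a : e ≡ suc a
      e≡a = ∣-antisym (divides d (≡.trans a≡ed (ℕ.*-comm e d))) (primitive⇒order∣ θʳ-prim e
              (trans (^-assocʳ θ (f ℕ.* d) e) (^-multiple≈1 (proj₁ θ-prim) a∣fd*e)))

  -- Monic polynomial functions and their roots

  -- Polynomials are handled only through their functions: Monic d f says that f agrees pointwise
  -- with a monic polynomial of degree d written in Horner form.
  data Monic : ℕ → (Carrier → Carrier) → Set (c ⊔ ℓ) where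
    one    : ∀ {f} → (∀ x → f x ≈ 1#) → Monic 0 f
    horner : ∀ {d f g} k → Monic d g → (∀ x → f x ≈ x * g x + k) → Monic (suc d) f

  monic-cong : ∀ {d f x y} → Monic d f → x ≈ y → f x ≈ f y
  monic-cong (one f≈1)         x≈y = trans (f≈1 _) (sym (f≈1 _))
  monic-cong (horner k g f≈xg) x≈y =
    trans (f≈xg _) (trans (+-congʳ (*-cong x≈y (monic-cong g x≈y))) (sym (f≈xg _)))

  monic-^ : ∀ d → Monic d (_^ d)
  monic-^ zero    = one (λ _ → refl)
  monic-^ (suc d) = horner 0# (monic-^ d) (λ _ → sym (+-identityʳ _))

  -- Stated at w + a rather than at x = (x - a) + a, so that each step is a semiring identity.
  monic-expand-at : ∀ {d f} → Monic (suc d) f → ∀ a →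
    Σ (Carrier → Carrier) λ h → Monic d h × (∀ w → f (w + a) ≈ w * h (w + a) + f a)
  monic-expand-at {f = f} (horner {g = g} k (one g≈1) f≈xg) a =
    (λ _ → 1#) , one (λ _ → refl) , λ w → begin
      f (w + a)                  ≈⟨ f≈xg (w + a) ⟩
      (w + a) * g (w + a) + k    ≈⟨ +-congʳ (*-congˡ (trans (g≈1 _) (sym (g≈1 a)))) ⟩
      (w + a) * g a + k          ≈⟨ shift w a (g a) k ⟩
      w * g a + (a * g a + k)    ≈⟨ +-cong (*-congˡ (g≈1 a)) (sym (f≈xg a)) ⟩
      w * 1# + f a               ∎
    where
    shift : ∀ w a G k → (w + a) * G + k ≈ w * G + (a * G + k)
    shift = solve 4 (λ w a G k → (w :+ a) :* G :+ k := w :* G :+ (a :* G :+ k)) refl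
  monic-expand-at {f = f} (horner {g = g} k g-monic@(horner _ _ _) f≈xg) a
    with monic-expand-at g-monic a
  ... | h , h-monic , g≈wh = (λ y → y * h y + g a) , horner (g a) h-monic (λ _ → refl) , λ w → begin
    f (w + a)                                        ≈⟨ f≈xg (w + a) ⟩
    (w + a) * g (w + a) + k                          ≈⟨ +-congʳ (*-congˡ (g≈wh w)) ⟩
    (w + a) * (w * h (w + a) + g a) + k              ≈⟨ shift w a (h (w + a)) (g a) k ⟩
    w * ((w + a) * h (w + a) + g a) + (a * g a + k)  ≈⟨ +-congˡ (sym (f≈xg a)) ⟩
    w * ((w + a) * h (w + a) + g a) + f a            ∎
    where
    shift : ∀ w a H G k → (w + a) * (w * H + G) + k ≈ w * ((w + a) * H + G) + (a * G + k)
    shift = solve 5 (λ w a H G k →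
      (w :+ a) :* (w :* H :+ G) :+ k := w :* ((w :+ a) :* H :+ G) :+ (a :* G :+ k)) refl

  monic-divide : ∀ {d f} → Monic (suc d) f → ∀ a →
    Σ (Carrier → Carrier) λ h → Monic d h × (∀ x → f x ≈ (x - a) * h x + f a)
  monic-divide {f = f} f-monic a with monic-expand-at f-monic a
  ... | h , h-monic , f≈wh = h , h-monic , λ x → begin
    f x                          ≈⟨ monic-cong f-monic (sym (//-rightDividesˡ a x)) ⟩
    f (x - a + a)                ≈⟨ f≈wh (x - a) ⟩
    (x - a) * h (x - a + a) + f a ≈⟨ +-congʳ (*-congˡ (monic-cong h-monic (//-rightDividesˡ a x))) ⟩
    (x - a) * h x + f a          ∎

  monic-roots : ∀ {u d f} {U : Pred ℕ u} (U? : Decidable U) N (r : ℕ → Carrier) →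
    Monic d f → d ≡ count U? N →
    (∀ {i} → i < N → U i → f (r i) ≈ 0#) →
    (∀ {i j} → i < j → j < N → U i → U j → r i ≉ r j) →
    ∀ x → f x ≈ Π N (λ i → factorIf (U? i) (x - r i))
  monic-roots U? zero r (one f≈1) ≡.refl roots distinct x = f≈1 x
  monic-roots {f = f} {U} U? (suc N) r f-monic ≡.refl roots distinct x with U? N
  ... | no _ = trans (monic-roots U? N r f-monic ≡.refl (roots ∘ ℕ.m<n⇒m<1+n)
                       (λ i<j → distinct i<j ∘ ℕ.m<n⇒m<1+n) x) (sym (*-identityˡ _))
  ... | yes u with monic-divide f-monic (r N)
  ...   | h , h-monic , f≈xh = begin
    f x                         ≈⟨ f≈xh x ⟩
    (x - r N) * h x + f (r N)   ≈⟨ +-congˡ (roots (ℕ.n<1+n N) u) ⟩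
    (x - r N) * h x + 0#        ≈⟨ +-identityʳ _ ⟩
    (x - r N) * h x             ≈⟨ *-congˡ (monic-roots U? N r h-monic ≡.refl h-roots
                                                      (λ i<j → distinct i<j ∘ ℕ.m<n⇒m<1+n) x) ⟩
    (x - r N) * Π N (λ i → factorIf (U? i) (x - r i)) ∎
    where
    h-roots : ∀ {i} → i < N → U i → h (r i) ≈ 0#
    h-roots {i} i<N uᵢ = x*y≈0⇒y≈0 (x≉y⇒x-y≉0 (distinct i<N (ℕ.n<1+n N) uᵢ u)) (begin
      (r i - r N) * h (r i)            ≈⟨ sym (+-identityʳ _) ⟩
      (r i - r N) * h (r i) + 0#       ≈⟨ +-congˡ (sym (roots (ℕ.n<1+n N) u)) ⟩
      (r i - r N) * h (r i) + f (r N)  ≈⟨ sym (f≈xh (r i)) ⟩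
      f (r i)                          ≈⟨ roots (ℕ.m<n⇒m<1+n i<N) uᵢ ⟩
      0#                               ∎)

  Π-x-bωᵗ : ∀ {e ω} → IsPrimitiveRoot F (suc e) ω → ∀ {b} → b ≉ 0# → ∀ x →
    Π (suc e) (λ t → x - b * ω ^ t) ≈ x ^ suc e - b ^ suc e
  Π-x-bωᵗ {e} {ω} ω-prim {b} b≉0 x =
    sym (monic-roots (λ _ → yes tt) (suc e) (λ t → b * ω ^ t)
           (horner (- b ^ suc e) (monic-^ e) (λ _ → refl)) (≡.sym (count-all (suc e))) roots distinct x)
    where
    roots : ∀ {t} → t < suc e → ⊤ → (b * ω ^ t) ^ suc e - b ^ suc e ≈ 0#
    roots {t} _ _ = x≈y⇒x∙y⁻¹≈ε (begin
      (b * ω ^ t) ^ suc e          ≈⟨ ^-distrib-* b (ω ^ t) (suc e) ⟩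
      b ^ suc e * (ω ^ t) ^ suc e  ≈⟨ *-congˡ (^-comm ω t (suc e)) ⟩
      b ^ suc e * (ω ^ suc e) ^ t  ≈⟨ *-congˡ (trans (^-congˡ t (proj₁ ω-prim)) (1^n≈1 t)) ⟩
      b ^ suc e * 1#               ≈⟨ *-identityʳ _ ⟩
      b ^ suc e                    ∎)
    distinct : ∀ {i j} → i < j → j < suc e → ⊤ → ⊤ → b * ω ^ i ≉ b * ω ^ j
    distinct i<j j<e _ _ = primitive-^-injective ω-prim i<j j<e ∘ *-cancelˡ b≉0

  rootProduct : ∀ {u} {U : Pred ℕ u} → Decidable U → ℕ → Carrier → Carrier → Carrier
  rootProduct U? N ζ x = Π N (λ j → factorIf (U? j) (x - ζ ^ j))

  rootProduct-cong : ∀ {u} {U : Pred ℕ u} (U? : Decidable U) N {ζ ζ′ x x′} →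
    ζ ≈ ζ′ → x ≈ x′ → rootProduct U? N ζ x ≈ rootProduct U? N ζ′ x′
  rootProduct-cong U? N ζ≈ζ′ x≈x′ =
    Π-cong N (λ {j} _ → factorIf-congʳ (U? j) (//-cong₂ x≈x′ (^-congˡ j ζ≈ζ′)))

  rootProduct-fold : ∀ {u} {U : Pred ℕ u} (U? : Decidable U) e a {η} →
    IsPrimitiveRoot F (suc e ℕ.* suc a) η → (∀ r t → U (r ℕ.+ t ℕ.* suc a) ⇔ U r) → ∀ x →
    rootProduct U? (suc e ℕ.* suc a) η x ≈ rootProduct U? (suc a) (η ^ suc e) (x ^ suc e)
  rootProduct-fold U? e a {η} η-prim U-periodic x = begin
    Π (E ℕ.* A) (λ j → factorIf (U? j) (x - η ^ j))
      ≈⟨ Π-* E A _ ⟩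
    Π E (λ t → Π A (λ r → factorIf (U? (r ℕ.+ t ℕ.* A)) (x - η ^ (r ℕ.+ t ℕ.* A))))
      ≈⟨ Π-cong E (λ {t} _ → Π-cong A (λ {r} _ →
           factorIf-cong (U-periodic r t) (U? _) (U? r) (//-cong₂ refl (η^[r+tA] r t)))) ⟩
    Π E (λ t → Π A (λ r → factorIf (U? r) (x - η ^ r * ω ^ t)))
      ≈⟨ Π-swap E A _ ⟩
    Π A (λ r → Π E (λ t → factorIf (U? r) (x - η ^ r * ω ^ t)))
      ≈⟨ Π-cong A (λ {r} _ → Π-factorIf E (U? r) _) ⟩
    Π A (λ r → factorIf (U? r) (Π E (λ t → x - η ^ r * ω ^ t)))
      ≈⟨ Π-cong A (λ {r} _ → factorIf-congʳ (U? r) (begin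
           Π E (λ t → x - η ^ r * ω ^ t)  ≈⟨ Π-x-bωᵗ ω-prim (^-≉0 r (primitive⇒≉0 η-prim)) x ⟩
           x ^ E - (η ^ r) ^ E            ≈⟨ //-cong₂ refl (^-comm η r E) ⟩
           x ^ E - (η ^ E) ^ r            ∎)) ⟩
    Π A (λ r → factorIf (U? r) (x ^ E - (η ^ E) ^ r)) ∎
    where
    E = suc e
    A = suc a
    ω = η ^ A
    ω-prim : IsPrimitiveRoot F E ω
    ω-prim = primitive-^ a E (≡.subst (λ n → IsPrimitiveRoot F n η) (ℕ.*-comm E A) η-prim)
    η^[r+tA] : ∀ r t → η ^ (r ℕ.+ t ℕ.* A) ≈ η ^ r * ω ^ t
    η^[r+tA] r t = begin
      η ^ (r ℕ.+ t ℕ.* A)    ≈⟨ ^-homo-* η r (t ℕ.* A) ⟩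
      η ^ r * η ^ (t ℕ.* A)  ≈⟨ *-congˡ (trans (^-congʳ η (ℕ.*-comm t A)) (sym (^-assocʳ η A t))) ⟩
      η ^ r * ω ^ t          ∎

  geometric : ℕ → Carrier → Carrier
  geometric zero    y = 1#
  geometric (suc i) y = y * geometric i y + 1#

  geometric-cong : ∀ i {y z} → y ≈ z → geometric i y ≈ geometric i z
  geometric-cong zero    y≈z = refl
  geometric-cong (suc i) y≈z = +-congʳ (*-cong y≈z (geometric-cong i y≈z))

  geometric-1 : ∀ i → geometric i 1# ≈ suc i ×ᴿ 1#
  geometric-1 zero    = sym (+-identityʳ 1#)
  geometric-1 (suc i) = trans (+-congʳ (trans (*-identityˡ _) (geometric-1 i))) (+-comm _ 1#)

  geometric-telescope : ∀ i y → y * geometric i y + 1# ≈ geometric i y + y ^ suc i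
  geometric-telescope zero    y = +-comm _ _
  geometric-telescope (suc i) y = begin
    y * (y * G + 1#) + 1#           ≈⟨ +-congʳ (*-congˡ (geometric-telescope i y)) ⟩
    y * (G + y ^ suc i) + 1#        ≈⟨ rearrange y G (y ^ suc i) ⟩
    (y * G + 1#) + y ^ suc (suc i)  ∎
    where
    G = geometric i y
    rearrange : ∀ y G P → y * (G + P) + 1# ≈ (y * G + 1#) + y * P
    rearrange = solve 3 (λ y G P → y :* (G :+ P) :+ con 1 := (y :* G :+ con 1) :+ y :* P) refl

  geometric-root : ∀ i {y} → y ^ suc i ≈ 1# → y ≉ 1# → geometric i y ≈ 0#
  geometric-root i {y} yⁱ⁺¹≈1 y≉1 = x*z≈y*z⇒z≈0 y≉1 (∙-cancelʳ 1# _ _ (begin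
    y * G + 1#     ≈⟨ geometric-telescope i y ⟩
    G + y ^ suc i  ≈⟨ +-congˡ yⁱ⁺¹≈1 ⟩
    G + 1#         ≈⟨ +-congʳ (sym (*-identityˡ G)) ⟩
    1# * G + 1#    ∎))
    where G = geometric i y

  monic-x^*+ : ∀ e {d g} → Monic d g → ∀ k → Monic (suc e ℕ.+ d) (λ x → x ^ suc e * g x + k)
  monic-x^*+ zero    g-monic k = horner k g-monic (λ x → +-congʳ (*-congʳ (*-identityʳ x)))
  monic-x^*+ (suc e) g-monic k = horner k (monic-x^*+ e g-monic 0#)
    (λ x → +-congʳ (trans (*-assoc x (x ^ suc e) _) (*-congˡ (sym (+-identityʳ _)))))

  monic-geometric-^ : ∀ i e → Monic (i ℕ.* suc e) (λ x → geometric i (x ^ suc e))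
  monic-geometric-^ zero    e = one (λ _ → refl)
  monic-geometric-^ (suc i) e = monic-x^*+ e (monic-geometric-^ i e) 1#

  rootProduct-∤ : ∀ m p₁ {ζ} → IsPrimitiveRoot F (suc m ℕ.* suc p₁) ζ → ∀ x →
    rootProduct (λ j → ¬? (suc p₁ ∣? j)) (suc m ℕ.* suc p₁) ζ x ≈ geometric p₁ (x ^ suc m)
  rootProduct-∤ m p₁ {ζ} ζ-prim x =
    sym (monic-roots (λ j → ¬? (p ∣? j)) (M ℕ.* p) (ζ ^_) (monic-geometric-^ p₁ m)
           (≡.trans (ℕ.*-comm p₁ M) (≡.sym (count-∤ M p₁))) roots
           (λ i<j j<n _ _ → primitive-^-injective ζ-prim i<j j<n) x)
    where
    p = suc p₁
    M = suc m
    roots : ∀ {j} → j < M ℕ.* p → ¬ p ∣ j → geometric p₁ ((ζ ^ j) ^ M) ≈ 0#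
    roots {j} _ p∤j = geometric-root p₁ yᵖ≈1 y≉1
      where
      yᵖ≈1 : ((ζ ^ j) ^ M) ^ p ≈ 1#
      yᵖ≈1 = begin
        ((ζ ^ j) ^ M) ^ p   ≈⟨ ^-assocʳ (ζ ^ j) M p ⟩
        (ζ ^ j) ^ (M ℕ.* p) ≈⟨ ^-comm ζ j (M ℕ.* p) ⟩
        (ζ ^ (M ℕ.* p)) ^ j ≈⟨ ^-congˡ j (proj₁ ζ-prim) ⟩
        1# ^ j              ≈⟨ 1^n≈1 j ⟩
        1#                  ∎
      y≉1 : (ζ ^ j) ^ M ≉ 1#
      y≉1 y≈1 = p∤j (*-cancelʳ-∣ M (≡.subst (_∣ j ℕ.* M) (ℕ.*-comm M p)
                  (primitive⇒order∣ ζ-prim (j ℕ.* M) (trans (sym (^-assocʳ ζ j M)) y≈1))))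

  module _ {u} {U : Pred ℕ u} (U? : Decidable U) (p₁ q₁ a₁ : ℕ) {ζ ξ : Carrier} where
    private
      p = suc p₁
      q = suc q₁
      a = suc a₁
      θ = ζ ^ (p ℕ.* q)

    -- The U-part of the product and its sub-product over multiples of p both fold to the same
    -- product over r < a, so the remaining factors multiply to 1 once that product is nonzero.
    rootProduct-¬∣-≈1 : IsPrimitiveRoot F ((p ℕ.* q) ℕ.* a) ζ → ξ ^ p ≈ ξ → ξ ^ q ≈ ξ →
      (∀ r t → U (r ℕ.+ t ℕ.* a) ⇔ U r) → (∀ r → U (r ℕ.* p) ⇔ U r) →
      rootProduct U? a θ ξ ≉ 0# →
      Π ((p ℕ.* q) ℕ.* a) (λ j → factorIf (¬? (p ∣? j)) (factorIf (U? j) (ξ - ζ ^ j))) ≈ 1#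
    rootProduct-¬∣-≈1 ζ-prim ξᵖ≈ξ ξ^q≈ξ U-periodic U-*p C≉0 =
      *-cancelˡ C≉0 (trans (*-comm C X) (trans XC≈C (sym (*-identityʳ C))))
      where
      n = (p ℕ.* q) ℕ.* a
      C = rootProduct U? a θ ξ
      X = Π n (λ j → factorIf (¬? (p ∣? j)) (factorIf (U? j) (ξ - ζ ^ j)))
      B = Π n (λ j → factorIf (p ∣? j) (factorIf (U? j) (ξ - ζ ^ j)))
      ξ^pq≈ξ : ξ ^ (p ℕ.* q) ≈ ξ
      ξ^pq≈ξ = trans (sym (^-assocʳ ξ p q)) (trans (^-congˡ q ξᵖ≈ξ) ξ^q≈ξ)
      ζᵖ-prim : IsPrimitiveRoot F (q ℕ.* a) (ζ ^ p)
      ζᵖ-prim = primitive-^ p₁ (q ℕ.* a)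
                  (≡.subst (λ k → IsPrimitiveRoot F k ζ) (ℕ.*-assoc p q a) ζ-prim)
      all≈C : rootProduct U? n ζ ξ ≈ C
      all≈C = trans (rootProduct-fold U? (q₁ ℕ.+ p₁ ℕ.* q) a₁ ζ-prim U-periodic ξ)
                    (rootProduct-cong U? a refl ξ^pq≈ξ)
      multiples≈C : B ≈ C
      multiples≈C = begin
        B
          ≡⟨ ≡.cong (λ k → Π k (λ j → factorIf (p ∣? j) (factorIf (U? j) (ξ - ζ ^ j)))) n≡qa*p ⟩
        Π ((q ℕ.* a) ℕ.* p) (λ j → factorIf (p ∣? j) (factorIf (U? j) (ξ - ζ ^ j)))
          ≈⟨ Π-multiples (q ℕ.* a) p₁ _ ⟩
        Π (q ℕ.* a) (λ i → factorIf (U? (i ℕ.* p)) (ξ - ζ ^ (i ℕ.* p)))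
          ≈⟨ Π-cong (q ℕ.* a) (λ {i} _ → factorIf-cong (U-*p i) (U? _) (U? i)
               (//-cong₂ refl (trans (^-congʳ ζ (ℕ.*-comm i p)) (sym (^-assocʳ ζ p i))))) ⟩
        rootProduct U? (q ℕ.* a) (ζ ^ p) ξ
          ≈⟨ rootProduct-fold U? q₁ a₁ ζᵖ-prim U-periodic ξ ⟩
        rootProduct U? a ((ζ ^ p) ^ q) (ξ ^ q)
          ≈⟨ rootProduct-cong U? a (^-assocʳ ζ p q) ξ^q≈ξ ⟩
        C ∎
        where
        n≡qa*p : n ≡ (q ℕ.* a) ℕ.* p
        n≡qa*p = ≡.trans (ℕ.*-assoc p q a) (ℕ.*-comm p (q ℕ.* a))
      XB≈all : X * B ≈ rootProduct U? n ζ ξ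
      XB≈all = trans (sym (Π-∙ n _ _)) (Π-cong n (λ {j} _ →
        trans (*-comm _ _) (factorIf-complement (p ∣? j) (factorIf (U? j) (ξ - ζ ^ j)))))
      XC≈C : X * C ≈ C
      XC≈C = trans (*-congˡ (sym multiples≈C)) (trans XB≈all all≈C)

  -- partialΦ n ζ x j runs over 1 ≤ i ≤ j, rootProduct over 0 ≤ i ≤ j.
  partialΦ-rootProduct : ∀ {n} ζ x → ¬ Coprime 0 n → ∀ j →
    partialΦ F n ζ x j ≈ rootProduct (λ i → coprime? i n) (suc j) ζ x
  partialΦ-rootProduct {n} ζ x 0∤n zero =
    sym (trans (*-congʳ (factorIf-no (coprime? 0 n) 0∤n _)) (*-identityˡ 1#))
  partialΦ-rootProduct {n} ζ x 0∤n (suc j) with coprime? (suc j) n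
  ... | yes c = *-cong (sym (factorIf-yes (coprime? (suc j) n) c _)) (partialΦ-rootProduct ζ x 0∤n j)
  ... | no ¬c = trans (partialΦ-rootProduct ζ x 0∤n j)
                  (sym (trans (*-congʳ (factorIf-no (coprime? (suc j) n) ¬c _)) (*-identityˡ _)))

  cycloEval-rootProduct : ∀ {n} ζ x → n ≢ 1 →
    cycloEval F n ζ x ≈ rootProduct (λ i → coprime? i n) n ζ x
  cycloEval-rootProduct {n} ζ x n≢1 = begin
    partialΦ F n ζ x n                                       ≈⟨ partialΦ-rootProduct ζ x 0∤n n ⟩
    factorIf (coprime? n n) (x - ζ ^ n) * rootProduct ⊥n? n ζ x
                                                             ≈⟨ *-congʳ (factorIf-no (coprime? n n) n∤n _) ⟩
    1# * rootProduct ⊥n? n ζ x                               ≈⟨ *-identityˡ _ ⟩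
    rootProduct ⊥n? n ζ x                                    ∎
    where
    ⊥n? = λ i → coprime? i n
    0∤n : ¬ Coprime 0 n
    0∤n 0⊥n = n≢1 (0⊥n (divides 0 ≡.refl , ∣-refl))
    n∤n : ¬ Coprime n n
    n∤n n⊥n = n≢1 (n⊥n (∣-refl , ∣-refl))

  -- Φ_n(ξ) for n = p^(k+1)·a

  module _ {p₁ k a₁ m₁ : ℕ} {ζ ξ : Carrier}
           (p-prime : Prime (suc p₁)) (p∤a : ¬ suc p₁ ∣ suc a₁)
           (ζ-prim : IsPrimitiveRoot F (suc p₁ ℕ.^ suc k ℕ.* suc a₁) ζ)
           (ξ-prim : IsPrimitiveRoot F (suc m₁) ξ) (m∣p-1 : suc m₁ ∣ p₁) where
    private
      p = suc p₁
      a = suc a₁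
      m = suc m₁
      n = p ℕ.^ suc k ℕ.* a
      q₁ = ℕ.pred (p ℕ.^ k)
      q = suc q₁
      q≡pᵏ : q ≡ p ℕ.^ k
      q≡pᵏ = ℕ.suc-pred (p ℕ.^ k) {{ℕ.m^n≢0 p k}}
      N = (p ℕ.* q) ℕ.* a
      N≡n : N ≡ n
      N≡n = ≡.cong (λ e → (p ℕ.* e) ℕ.* a) q≡pᵏ
      ζ-prim′ : IsPrimitiveRoot F N ζ
      ζ-prim′ = ≡.subst (λ e → IsPrimitiveRoot F e ζ) (≡.sym N≡n) ζ-prim
      θ = ζ ^ (p ℕ.* q)
      θ-prim : IsPrimitiveRoot F a θ
      θ-prim = primitive-^ (q₁ ℕ.+ p₁ ℕ.* q) a ζ-prim′
      ξᵖ≈ξ : ξ ^ p ≈ ξ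
      ξᵖ≈ξ = ^-suc-multiple (proj₁ ξ-prim) m∣p-1
      ξ^q≈ξ : ξ ^ q ≈ ξ
      ξ^q≈ξ = trans (^-congʳ ξ q≡pᵏ) (^-fixed-^ p ξᵖ≈ξ k)

      restricted : ∀ {u} {U : Pred ℕ u} → Decidable U → Carrier
      restricted U? = Π N (λ j → factorIf (¬? (p ∣? j)) (factorIf (U? j) (ξ - ζ ^ j)))

      cycloEval≈restricted : cycloEval F n ζ ξ ≈ restricted (λ j → coprime? j a)
      cycloEval≈restricted = begin
        cycloEval F n ζ ξ
          ≈⟨ cycloEval-rootProduct ζ ξ n≢1 ⟩
        rootProduct (λ j → coprime? j n) n ζ ξ
          ≈⟨ Π-cong n (λ {j} _ →
               factorIf-× (coprime-p^k*a⇔ p-prime k) (coprime? j n) (¬? (p ∣? j)) (coprime? j a) _) ⟩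
        Π n (λ j → factorIf (¬? (p ∣? j)) (factorIf (coprime? j a) (ξ - ζ ^ j)))
          ≡⟨ ≡.cong (λ e → Π e (λ j → factorIf (¬? (p ∣? j)) (factorIf (coprime? j a) (ξ - ζ ^ j))))
                    N≡n ⟨
        restricted (λ j → coprime? j a) ∎
        where
        p∣n : p ∣ n
        p∣n = ∣m⇒∣m*n a (m∣m*n (p ℕ.^ k))
        n≢1 : n ≢ 1
        n≢1 n≡1 = ¬prime[1] (≡.subst Prime (∣1⇒≡1 (≡.subst (p ∣_) n≡1 p∣n)) p-prime)

      restricted-coprime-≈1 : rootProduct (λ r → coprime? r a) a θ ξ ≉ 0# →
        restricted (λ j → coprime? j a) ≈ 1#
      restricted-coprime-≈1 =
        rootProduct-¬∣-≈1 (λ r → coprime? r a) p₁ q₁ a₁ ζ-prim′ ξᵖ≈ξ ξ^q≈ξ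
          (λ _ t → coprime-+*⇔ t) (λ _ → coprime-*p⇔ p-prime p∤a)

      restricted-noncoprime-≈1 : rootProduct (λ r → ¬? (coprime? r a)) a θ ξ ≉ 0# →
        restricted (λ j → ¬? (coprime? j a)) ≈ 1#
      restricted-noncoprime-≈1 =
        rootProduct-¬∣-≈1 (λ r → ¬? (coprime? r a)) p₁ q₁ a₁ ζ-prim′ ξᵖ≈ξ ξ^q≈ξ
          (λ _ t → ¬-cong-⇔ (coprime-+*⇔ t)) (λ _ → ¬-cong-⇔ (coprime-*p⇔ p-prime p∤a))

    cycloEval-≈1 : a ≢ m → cycloEval F n ζ ξ ≈ 1#
    cycloEval-≈1 a≢m = trans cycloEval≈restricted (restricted-coprime-≈1 (Π-≉0 a (λ {r} _ →
      factorIf-≉0 (coprime? r a) (λ r⊥a → x≉y⇒x-y≉0 (ξ≉θʳ r⊥a)))))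
      where
      ξ≉θʳ : ∀ {r} → Coprime r a → ξ ≉ θ ^ r
      ξ≉θʳ r⊥a ξ≈θʳ = a≢m (≡.sym (primitive-order-unique ξ-prim
        (IsPrimitiveRoot-resp-≈ (sym ξ≈θʳ) (primitive-^-coprime θ-prim r⊥a))))

    cycloEval-≈p : a ≡ m → cycloEval F n ζ ξ ≈ p ×ᴿ 1#
    cycloEval-≈p ≡.refl = begin
      cycloEval F n ζ ξ
        ≈⟨ cycloEval≈restricted ⟩
      restricted U?
        ≈⟨ sym (trans (*-congˡ (restricted-noncoprime-≈1 C¬U≉0)) (*-identityʳ _)) ⟩
      restricted U? * restricted (¬? ∘ U?)
        ≈⟨ sym (Π-∙ N _ _) ⟩
      Π N (λ j → factorIf (p∤? j) (factorIf (U? j) (ξ - ζ ^ j))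
                 * factorIf (p∤? j) (factorIf (¬? (U? j)) (ξ - ζ ^ j)))
        ≈⟨ Π-cong N (λ {j} _ → trans (sym (factorIf-∙ (p∤? j) _ _))
                                      (factorIf-congʳ (p∤? j) (factorIf-complement (U? j) _))) ⟩
      rootProduct p∤? N ζ ξ
        ≡⟨ ≡.cong (λ e → rootProduct p∤? e ζ ξ) N≡qa*p ⟩
      rootProduct p∤? ((q ℕ.* a) ℕ.* p) ζ ξ
        ≈⟨ rootProduct-∤ (a₁ ℕ.+ q₁ ℕ.* a) p₁ ζ-prim″ ξ ⟩
      geometric p₁ (ξ ^ (q ℕ.* a))
        ≈⟨ geometric-cong p₁ (^-multiple≈1 {n = a} (proj₁ ξ-prim) (n∣m*n q)) ⟩
      geometric p₁ 1#
        ≈⟨ geometric-1 p₁ ⟩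
      p ×ᴿ 1# ∎
      where
      U? = λ j → coprime? j a
      p∤? = λ j → ¬? (p ∣? j)
      N≡qa*p : N ≡ (q ℕ.* a) ℕ.* p
      N≡qa*p = ≡.trans (ℕ.*-assoc p q a) (ℕ.*-comm p (q ℕ.* a))
      ζ-prim″ : IsPrimitiveRoot F ((q ℕ.* a) ℕ.* p) ζ
      ζ-prim″ = ≡.subst (λ e → IsPrimitiveRoot F e ζ) N≡qa*p ζ-prim′
      ξ≉θʳ : ∀ {r} → ¬ Coprime r a → ξ ≉ θ ^ r
      ξ≉θʳ ¬r⊥a ξ≈θʳ = ¬r⊥a (primitive-^⇒coprime θ-prim (IsPrimitiveRoot-resp-≈ ξ≈θʳ ξ-prim))
      C¬U≉0 : rootProduct (¬? ∘ U?) a θ ξ ≉ 0#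
      C¬U≉0 = Π-≉0 a (λ {r} _ → factorIf-≉0 (¬? (U? r)) (x≉y⇒x-y≉0 ∘ ξ≉θʳ))

open import Data.Nat using (_^_; _*_; _∸_)

lemma10 : ∀ {c ℓ} (F : Char0Field c ℓ) (m n : ℕ) → 1 ≤ m → 1 < n →
    (ζ ξ : Char0Field.Carrier F) →
    IsPrimitiveRoot F n ζ → IsPrimitiveRoot F m ξ →
    (p k n′ : ℕ) → Prime p → m ∣ (p ∸ 1) → 1 ≤ k →
    n ≡ p ^ k * n′ → ¬ (p ∣ n′) →
    (n′ ≢ m → Char0Field._≈_ F (cycloEval F n ζ ξ) (Char0Field.1# F))
    × (n′ ≡ m → Char0Field._≈_ F (cycloEval F n ζ ξ) (Char0Field._×_ F p (Char0Field.1# F)))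
lemma10 F zero _ ()
lemma10 F (suc _) _ _ _ _ _ _ _ _ zero _ _ _ ()
lemma10 F (suc _) _ _ _ _ _ _ _ zero (suc _) _ ()
lemma10 F (suc _) _ _ 1<n _ _ _ _ (suc p₁) (suc k) zero _ _ _ ≡.refl _ =
  ⊥-elim (ℕ.n≮0 (≡.subst (1 <_) (ℕ.*-zeroʳ (suc p₁ ^ suc k)) 1<n))
lemma10 F (suc _) _ _ _ _ _ ζ-prim ξ-prim (suc _) (suc k) (suc _) p-prime m∣p-1 _ ≡.refl p∤n′ =
  cycloEval-≈1 F {k = k} p-prime p∤n′ ζ-prim ξ-prim m∣p-1 ,
  cycloEval-≈p F {k = k} p-prime p∤n′ ζ-prim ξ-prim m∣p-1
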